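{- Let $n\geqslant 4$ be an integer and let $S\subseteq \mathbb{Z}_n$ be such that the Cayley sum graph $\mathrm{CS}(\mathbb{Z}_n,S)$ is connected and of degree $k=|S|$, where $k\mid n$. Then $\mathrm{CS}(\mathbb{Z}_n,S)$ admits a subgroup total perfect code if and only if $s\not\equiv s'\pmod{k}$ for all distinct $s,s'\in S$.
   Context: For an additive group $G$ and a subset $S\subseteq G$ closed under conjugation (automatic when $G$ is abelian), the Cayley sum graph $\mathrm{CS}(G,S)$ has vertex set $G$, two vertices $g,h$ being adjacent if and only if $g+h\in S$ and $g\neq h$. A total perfect code of a graph $\Gamma$ is a subset $C$ of vertices such that every vertex of $\Gamma$ has exactly one neighbor in $C$. A subgroup total perfect code is a total perfect code of $\mathrm{CS}(G,S)$ that is also a subgroup of $G$. Elements of $\mathbb{Z}_n$ are identified with integers $0,\dots,n-1$. -}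

module Defs where

open import Data.Nat using (ℕ; zero; suc; NonZero; _+_; _∸_)
open import Data.Nat.DivMod using (_mod_)
open import Data.Fin using (Fin; toℕ)
open import Data.Fin.Properties using (_≟_)
open import Data.Fin.Subset using (Subset; _∈_; ∣_∣)
open import Data.Fin.Subset.Properties using (_∈?_)
open import Data.Vec using (tabulate)
open import Data.Product using (_×_; ∃!)
open import Relation.Nullary using (¬_; Dec; does)
open import Relation.Nullary.Decidable using (_×-dec_; ¬?)
open import Relation.Binary.PropositionalEquality using (_≡_)
open import Relation.Binary.Construct.Closure.ReflexiveTransitive using (Star)
open import Data.Integer as ℤ using (ℤ; +_)
open import Data.Integer.Divisibility as ℤd using ()

module _ (n : ℕ) .{{_ : NonZero n}} where

  0ₙ : Fin n
  0ₙ = 0 mod n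

  _⊕_ : Fin n → Fin n → Fin n
  g ⊕ h = (toℕ g + toℕ h) mod n

  ⊖_ : Fin n → Fin n
  ⊖ g = (n ∸ toℕ g) mod n

  Adj : Subset n → Fin n → Fin n → Set
  Adj S g h = ((g ⊕ h) ∈ S) × ¬ (g ≡ h)

  adj? : (S : Subset n) (g h : Fin n) → Dec (Adj S g h)
  adj? S g h = ((g ⊕ h) ∈? S) ×-dec ¬? (g ≟ h)

  nbhd : Subset n → Fin n → Subset n
  nbhd S g = tabulate (λ h → does (adj? S g h))

  degree : Subset n → Fin n → ℕ
  degree S g = ∣ nbhd S g ∣

  Regular : Subset n → ℕ → Set
  Regular S k = ∀ g → degree S g ≡ k

  Connected : Subset n → Set
  Connected S = ∀ g h → Star (Adj S) g h

  TotalPerfectCode : Subset n → Subset n → Set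
  TotalPerfectCode S C = ∀ g → ∃! _≡_ (λ h → (h ∈ C) × Adj S g h)

  IsSubgroup : Subset n → Set
  IsSubgroup C = (0ₙ ∈ C) × (∀ {g h} → g ∈ C → h ∈ C → (g ⊕ h) ∈ C)
                   × (∀ {g} → g ∈ C → (⊖ g) ∈ C)

  HasSubgroupTPC : Subset n → Set
  HasSubgroupTPC S = Data.Product.∃ λ C → IsSubgroup C × TotalPerfectCode S C

_≡_[mod_] : ℕ → ℕ → ℕ → Set
a ≡ b [mod k ] = (+ k) ℤd.∣ ((+ a) ℤ.- (+ b))

-- Since CS(ℤₙ,S) is |S|-regular and h ↦ g + h injects the neighbourhood of g into S, g + g ∉ S;
-- hence g + h ∈ S alone makes g and h adjacent.  A subgroup C of ℤₙ consists of the multiples of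
-- its least positive element d, a divisor of n.  If C is a total perfect code, then for s, s′ ∈ S
-- with d ∣ s − s′ both 0 and s − s′ are neighbours of s′ in C, so s = s′; and r ↦ r + c(r), with
-- c(r) the neighbour of r in C, maps the residues mod d injectively into S.  So S has exactly one
-- element in each residue class mod d and d = |S|.  Conversely, if the elements of S are pairwise
-- incongruent mod |S|, they meet every class, and the code neighbour of g in the multiples of |S|
-- is s − g for the s ∈ S congruent to g.

module Submission where

open import Defs
open import Data.Nat using (ℕ; NonZero; _≤_; zero; suc; _+_; _*_; _∸_; _<_; _<?_; _%_; z≤n; >-nonZero; >-nonZero⁻¹; ≢-nonZero; ≢-nonZero⁻¹)
open import Data.Nat.Properties using (≤-reflexive; ≤-total; ≤-antisym; ≤-<-trans; <⇒≱; <-irrefl; ≮⇒≥; n≤0⇒n≡0; +-comm; +-identityʳ; m+[n∸m]≡n; [m+n]∸[m+o]≡n∸o; *-distribʳ-∸; <⇒≤; +-commutativeSemigroup; module ≤-Reasoning)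
open import Algebra.Properties.CommutativeSemigroup +-commutativeSemigroup using (x∙yz≈y∙xz)
open import Data.Nat.DivMod using (_/_; _mod_; m≡m%n+[m/n]*n; m%n<n; m<n⇒m%n≡m; n%n≡0; [m+n]%n≡m%n; %-distribˡ-+; %-remove-+ʳ; m∣n⇒o%n%m≡o%m)
open import Data.Nat.Divisibility using (_∣_; divides; _∣?_; _∣0; 0∣⇒≡0; ∣m∣n⇒∣m+n; ∣m+n∣m⇒∣n; %-presˡ-∣; m%n≡0⇒n∣m)
open import Data.Integer as ℤ using (+_)
open import Data.Integer.Properties using ([+m]-[+n]≡m⊖n; ∣m⊖n∣≡∣n⊖m∣; ∣⊖∣-≤; ∣i-j∣≡∣j-i∣)
open import Data.Fin using (Fin; toℕ; zero; suc; fromℕ; fromℕ<)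
open import Data.Fin.Properties using (toℕ-injective; toℕ<n; toℕ-fromℕ<; toℕ-fromℕ; toℕ-inject; suc-injective; 0≢1+n; any?; ¬∀⟶∃¬-smallest; _≟_)
open import Data.Fin.Subset using (Subset; _∈_; _∉_; ∣_∣; _-_; ⊤; inside; outside)
open import Data.Fin.Subset.Properties using (_∈?_; ∈⊤; ∣⊤∣≡n; ⊆-antisym; x∈p⇒∣p-x∣<∣p∣; x∈p∧x≢y⇒x∈p-y)
open import Data.Vec using ([]; _∷_; here; there; tabulate)
open import Data.Vec.Properties using (lookup∘tabulate; []=⇒lookup; lookup⇒[]=)
open import Data.Product using (∃-syntax; _×_; _,_; proj₁; proj₂)
open import Data.Sum using (inj₁; inj₂)
open import Function using (_∘_)
open import Function.Bundles using (_⇔_; mk⇔; Equivalence)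
open import Function.Construct.Composition using (_⇔-∘_)
open import Level using (Level)
open import Relation.Nullary using (¬_; does; yes; no; contradiction)
open import Relation.Nullary.Decidable using (dec-true; decidable-stable; ¬?; _×-dec_)
open import Relation.Unary using (Pred; Decidable)
open import Relation.Binary.PropositionalEquality using (_≡_; _≢_; refl; sym; trans; cong; cong₂; subst; module ≡-Reasoning)

open Equivalence using (to; from)

private
  variable
    ℓ : Level
    a b m n : ℕ

MapsInto : (Fin m → Fin n) → Subset m → Subset n → Set
MapsInto f p q = ∀ {x} → x ∈ p → f x ∈ q

InjectiveOn : (Fin m → Fin n) → Subset m → Set
InjectiveOn f p = ∀ {x y} → x ∈ p → y ∈ p → f x ≡ f y → x ≡ y

injectiveOn⇒∣p∣≤∣q∣ : {p : Subset m} {q : Subset n} (f : Fin m → Fin n) →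
                      MapsInto f p q → InjectiveOn f p → ∣ p ∣ ≤ ∣ q ∣
injectiveOn⇒∣p∣≤∣q∣ {p = []} f into inj = z≤n
injectiveOn⇒∣p∣≤∣q∣ {p = outside ∷ p} f into inj =
  injectiveOn⇒∣p∣≤∣q∣ (f ∘ suc) (into ∘ there)
    (λ x∈p y∈p → suc-injective ∘ inj (there x∈p) (there y∈p))
injectiveOn⇒∣p∣≤∣q∣ {p = inside ∷ p} {q = q} f into inj = begin-strict
  ∣ p ∣          ≤⟨ injectiveOn⇒∣p∣≤∣q∣ (f ∘ suc) into′ inj′ ⟩
  ∣ q - f zero ∣ <⟨ x∈p⇒∣p-x∣<∣p∣ (into here) ⟩
  ∣ q ∣          ∎
  where
  open ≤-Reasoning
  into′ : MapsInto (f ∘ suc) p (q - f zero)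
  into′ x∈p = x∈p∧x≢y⇒x∈p-y (into (there x∈p)) (0≢1+n ∘ inj here (there x∈p) ∘ sym)
  inj′ : InjectiveOn (f ∘ suc) p
  inj′ x∈p y∈p = suc-injective ∘ inj (there x∈p) (there y∈p)

module _ {p : Subset m} {q : Subset n} (f : Fin m → Fin n)
         (into : MapsInto f p q) (inj : InjectiveOn f p) where

  injectiveOn-missing⇒∣p∣<∣q∣ : ∀ {y} → y ∈ q → (∀ {x} → x ∈ p → f x ≢ y) → ∣ p ∣ < ∣ q ∣
  injectiveOn-missing⇒∣p∣<∣q∣ y∈q missed = ≤-<-trans
    (injectiveOn⇒∣p∣≤∣q∣ f (λ x∈p → x∈p∧x≢y⇒x∈p-y (into x∈p) (missed x∈p)) inj)
    (x∈p⇒∣p-x∣<∣p∣ y∈q)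

  injectiveOn⇒onto : ∣ q ∣ ≤ ∣ p ∣ → ∀ {y} → y ∈ q → ∃[ x ] x ∈ p × f x ≡ y
  injectiveOn⇒onto ∣q∣≤∣p∣ {y} y∈q with any? (λ x → (x ∈? p) ×-dec (f x ≟ y))
  ... | yes hit = hit
  ... | no none = contradiction ∣q∣≤∣p∣
        (<⇒≱ (injectiveOn-missing⇒∣p∣<∣q∣ y∈q (λ x∈p fx≡y → none (_ , x∈p , fx≡y))))

module _ {P : Pred (Fin n) ℓ} (P? : Decidable P) {x : Fin n} where

  ∈-tabulate⁺ : P x → x ∈ tabulate (does ∘ P?)
  ∈-tabulate⁺ Px = lookup⇒[]= x _ (trans (lookup∘tabulate (does ∘ P?) x) (dec-true (P? x) Px))

  ∈-tabulate⁻ : x ∈ tabulate (does ∘ P?) → P x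
  ∈-tabulate⁻ x∈ with P? x | trans (sym (lookup∘tabulate (does ∘ P?) x)) ([]=⇒lookup x∈)
  ... | yes Px | _ = Px

module _ {d : ℕ} .{{_ : NonZero d}} where

  0%d≡0 : 0 % d ≡ 0
  0%d≡0 = m<n⇒m%n≡m (>-nonZero⁻¹ d)

  toℕ-mod : ∀ a → toℕ (a mod d) ≡ a % d
  toℕ-mod a = toℕ-fromℕ< (m%n<n a d)

  mod≡mod⇒%≡% : a mod d ≡ b mod d → a % d ≡ b % d
  mod≡mod⇒%≡% {a} {b} eq = trans (sym (toℕ-mod a)) (trans (cong toℕ eq) (toℕ-mod b))

  %≡%⇒mod≡mod : a % d ≡ b % d → a mod d ≡ b mod d
  %≡%⇒mod≡mod {a} {b} eq = toℕ-injective (trans (toℕ-mod a) (trans eq (sym (toℕ-mod b))))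

  %≡%⇒∣∸ : ∀ a b → a % d ≡ b % d → d ∣ a ∸ b
  %≡%⇒∣∸ a b eq = divides (a / d ∸ b / d) (begin
    a ∸ b                       ≡⟨ cong₂ _∸_ (m≡m%n+[m/n]*n a d) (m≡m%n+[m/n]*n b d) ⟩
    (a % d + qa) ∸ (b % d + qb) ≡⟨ cong (λ r → (r + qa) ∸ (b % d + qb)) eq ⟩
    (b % d + qa) ∸ (b % d + qb) ≡⟨ [m+n]∸[m+o]≡n∸o (b % d) qa qb ⟩
    qa ∸ qb                     ≡⟨ *-distribʳ-∸ d (a / d) (b / d) ⟨
    (a / d ∸ b / d) * d         ∎)
    where
    open ≡-Reasoning
    qa qb : ℕ
    qa = a / d * d
    qb = b / d * d

  ∣∸⇒%≡% : b ≤ a → d ∣ a ∸ b → a % d ≡ b % d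
  ∣∸⇒%≡% {b} {a} b≤a d∣a∸b = begin
    a % d             ≡⟨ cong (_% d) (m+[n∸m]≡n b≤a) ⟨
    (b + (a ∸ b)) % d ≡⟨ %-remove-+ʳ b d∣a∸b ⟩
    b % d             ∎
    where open ≡-Reasoning

  %-cancelˡ-+ : ∀ a {b c} → (a + b) % d ≡ (a + c) % d → b % d ≡ c % d
  %-cancelˡ-+ a {b} {c} eq with ≤-total c b
  ... | inj₁ c≤b = ∣∸⇒%≡% c≤b (subst (d ∣_) ([m+n]∸[m+o]≡n∸o a b c) (%≡%⇒∣∸ _ _ eq))
  ... | inj₂ b≤c = sym (∣∸⇒%≡% b≤c (subst (d ∣_) ([m+n]∸[m+o]≡n∸o a c b) (%≡%⇒∣∸ _ _ (sym eq))))

  ≡[mod]⇔∣∸ : b ≤ a → (a ≡ b [mod d ]) ⇔ d ∣ a ∸ b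
  ≡[mod]⇔∣∸ {b} {a} b≤a = mk⇔ (subst (d ∣_) ∣a-b∣≡a∸b) (subst (d ∣_) (sym ∣a-b∣≡a∸b))
    where
    ∣a-b∣≡a∸b : ℤ.∣ + a ℤ.- + b ∣ ≡ a ∸ b
    ∣a-b∣≡a∸b = trans (cong ℤ.∣_∣ ([+m]-[+n]≡m⊖n a b)) (trans (∣m⊖n∣≡∣n⊖m∣ a b) (∣⊖∣-≤ b≤a))

  ≡[mod]-sym : ∀ a b → (a ≡ b [mod d ]) → (b ≡ a [mod d ])
  ≡[mod]-sym a b = subst (d ∣_) (∣i-j∣≡∣j-i∣ (+ a) (+ b))

  %≡%⇔≡[mod] : ∀ a b → a % d ≡ b % d ⇔ (a ≡ b [mod d ])
  %≡%⇔≡[mod] a b with ≤-total b a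
  ... | inj₁ b≤a = mk⇔ (from (≡[mod]⇔∣∸ b≤a) ∘ %≡%⇒∣∸ a b) (∣∸⇒%≡% b≤a ∘ to (≡[mod]⇔∣∸ b≤a))
  ... | inj₂ a≤b = mk⇔ (≡[mod]-sym b a ∘ from (≡[mod]⇔∣∸ a≤b) ∘ %≡%⇒∣∸ b a ∘ sym)
                       (sym ∘ ∣∸⇒%≡% a≤b ∘ to (≡[mod]⇔∣∸ a≤b) ∘ ≡[mod]-sym a b)

∣-nonZero : ∀ {d} → d ∣ n → .{{_ : NonZero n}} → NonZero d
∣-nonZero {n = n} d∣n = ≢-nonZero (λ d≡0 → ≢-nonZero⁻¹ n (0∣⇒≡0 (subst (_∣ n) d≡0 d∣n)))

least-witness : {P : Pred ℕ ℓ} → Decidable P → P m → ∃[ d ] P d × (∀ {i} → i < d → ¬ P i)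
-- d is the first point of Fin (suc m) where ¬ P fails; P m guarantees there is one.
least-witness {m = m} {P = P} P? Pm
  with (i , ¬¬Pi , below) ← ¬∀⟶∃¬-smallest (suc m) (¬_ ∘ P ∘ toℕ) (¬? ∘ P? ∘ toℕ)
                              (λ ∀¬P → ∀¬P (fromℕ m) (subst P (sym (toℕ-fromℕ m)) Pm))
  = toℕ i , decidable-stable (P? (toℕ i)) ¬¬Pi
  , λ j<i → subst (¬_ ∘ P) (trans (toℕ-inject (fromℕ< j<i)) (toℕ-fromℕ< j<i)) (below (fromℕ< j<i))

module _ {P : Pred ℕ ℓ} (P? : Decidable P) (P-0 : P 0) (P-+ : ∀ {a b} → P a → P b → P (a + b))
         (P-cancel : ∀ {a b} → P (a + b) → P b → P a) where

  cancellative-submonoid⇒multiples : 0 < m → P m → ∃[ d ] (∀ {a} → P a ⇔ d ∣ a)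
  cancellative-submonoid⇒multiples 0<m Pm
    with (d , (0<d , Pd) , least) ← least-witness (λ a → (0 <? a) ×-dec P? a) (0<m , Pm)
    = d , mk⇔ P⇒∣ ∣⇒P
    where
    instance
      _ : NonZero d
      _ = >-nonZero 0<d
    P-multiple : ∀ q → P (q * d)
    P-multiple zero    = P-0
    P-multiple (suc q) = P-+ Pd (P-multiple q)
    ∣⇒P : d ∣ a → P a
    ∣⇒P (divides q refl) = P-multiple q
    P⇒∣ : P a → d ∣ a
    P⇒∣ {a} Pa = m%n≡0⇒n∣m a d (n≤0⇒n≡0 (≮⇒≥ λ 0<r → least (m%n<n a d) (0<r , P[a%d])))
      where
      P[a%d] : P (a % d)
      P[a%d] = P-cancel (subst P (m≡m%n+[m/n]*n a d) Pa) (P-multiple (a / d))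

module _ {n : ℕ} .{{_ : NonZero n}} where

  infixl 6 _+ₙ_ _-ₙ_

  _+ₙ_ : Fin n → Fin n → Fin n
  _+ₙ_ = _⊕_ n

  _-ₙ_ : Fin n → Fin n → Fin n
  g -ₙ h = g +ₙ ⊖_ n h

  toℕ-0ₙ : toℕ (0ₙ n) ≡ 0
  toℕ-0ₙ = trans (toℕ-mod 0) 0%d≡0

  mod-toℕ : ∀ (g : Fin n) → toℕ g mod n ≡ g
  mod-toℕ g = toℕ-injective (trans (toℕ-mod (toℕ g)) (m<n⇒m%n≡m (toℕ<n g)))

  n-mod-n : n mod n ≡ 0ₙ n
  n-mod-n = %≡%⇒mod≡mod (trans (n%n≡0 n) (sym 0%d≡0))

  mod-+ : ∀ a b → (a + b) mod n ≡ a mod n +ₙ b mod n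
  mod-+ a b = %≡%⇒mod≡mod (begin
    (a + b) % n                          ≡⟨ %-distribˡ-+ a b n ⟩
    (a % n + b % n) % n                  ≡⟨ cong₂ (λ x y → (x + y) % n) (toℕ-mod a) (toℕ-mod b) ⟨
    (toℕ (a mod n) + toℕ (b mod n)) % n  ∎)
    where open ≡-Reasoning

  +ₙ-comm : ∀ g h → g +ₙ h ≡ h +ₙ g
  +ₙ-comm g h = cong (_mod n) (+-comm (toℕ g) (toℕ h))

  +ₙ-identityʳ : ∀ g → g +ₙ 0ₙ n ≡ g
  +ₙ-identityʳ g = begin
    (toℕ g + toℕ (0ₙ n)) mod n  ≡⟨ cong (λ x → (toℕ g + x) mod n) toℕ-0ₙ ⟩
    (toℕ g + 0) mod n           ≡⟨ cong (_mod n) (+-identityʳ (toℕ g)) ⟩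
    toℕ g mod n                 ≡⟨ mod-toℕ g ⟩
    g                           ∎
    where open ≡-Reasoning

  +ₙ-cancelˡ : ∀ g {h h′} → g +ₙ h ≡ g +ₙ h′ → h ≡ h′
  +ₙ-cancelˡ g {h} {h′} eq = trans (sym (mod-toℕ h))
    (trans (%≡%⇒mod≡mod (%-cancelˡ-+ (toℕ g) (mod≡mod⇒%≡% eq))) (mod-toℕ h′))

  x+ₙ[y-ₙx]≡y : ∀ g s → g +ₙ (s -ₙ g) ≡ s
  x+ₙ[y-ₙx]≡y g s = begin
    g +ₙ (s +ₙ ι (n ∸ i))        ≡⟨ cong₂ (λ x y → x +ₙ (y +ₙ ι (n ∸ i))) (mod-toℕ g) (mod-toℕ s) ⟨
    ι i +ₙ (ι j +ₙ ι (n ∸ i))    ≡⟨ cong (ι i +ₙ_) (mod-+ j (n ∸ i)) ⟨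
    ι i +ₙ ι (j + (n ∸ i))       ≡⟨ mod-+ i (j + (n ∸ i)) ⟨
    ι (i + (j + (n ∸ i)))        ≡⟨ cong ι (x∙yz≈y∙xz i j (n ∸ i)) ⟩
    ι (j + (i + (n ∸ i)))        ≡⟨ cong (λ x → ι (j + x)) (m+[n∸m]≡n (<⇒≤ (toℕ<n g))) ⟩
    ι (j + n)                    ≡⟨ %≡%⇒mod≡mod ([m+n]%n≡m%n j n) ⟩
    ι j                          ≡⟨ mod-toℕ s ⟩
    s                            ∎
    where
    open ≡-Reasoning
    ι : ℕ → Fin n
    ι a = a mod n
    i j : ℕ
    i = toℕ g
    j = toℕ s

  [x+ₙy]-ₙy≡x : ∀ g h → (g +ₙ h) -ₙ h ≡ g
  [x+ₙy]-ₙy≡x g h = +ₙ-cancelˡ h (trans (x+ₙ[y-ₙx]≡y h (g +ₙ h)) (+ₙ-comm g h))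

  module _ {d : ℕ} .{{_ : NonZero d}} (d∣n : d ∣ n) where

    toℕ-+ₙ-% : ∀ g h → toℕ (g +ₙ h) % d ≡ (toℕ g + toℕ h) % d
    toℕ-+ₙ-% g h = trans (cong (_% d) (toℕ-mod (toℕ g + toℕ h))) (m∣n⇒o%n%m≡o%m d n _ d∣n)

    %-remove-+ₙʳ : ∀ g {h} → d ∣ toℕ h → toℕ (g +ₙ h) % d ≡ toℕ g % d
    %-remove-+ₙʳ g {h} d∣h = trans (toℕ-+ₙ-% g h) (%-remove-+ʳ (toℕ g) d∣h)

    %≡%⇒∣toℕ[x-ₙy] : ∀ s g → toℕ s % d ≡ toℕ g % d → d ∣ toℕ (s -ₙ g)
    %≡%⇒∣toℕ[x-ₙy] s g eq = m%n≡0⇒n∣m _ d (trans (%-cancelˡ-+ (toℕ g) (begin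
      (toℕ g + toℕ (s -ₙ g)) % d  ≡⟨ toℕ-+ₙ-% g (s -ₙ g) ⟨
      toℕ (g +ₙ (s -ₙ g)) % d     ≡⟨ cong (λ x → toℕ x % d) (x+ₙ[y-ₙx]≡y g s) ⟩
      toℕ s % d                   ≡⟨ eq ⟩
      toℕ g % d                   ≡⟨ cong (_% d) (+-identityʳ (toℕ g)) ⟨
      (toℕ g + 0) % d             ∎)) 0%d≡0)
      where open ≡-Reasoning

  Multiples : ℕ → Subset n
  Multiples d = tabulate (λ g → does (d ∣? toℕ g))

  module _ {d : ℕ} {g : Fin n} where

    ∈-Multiples⁺ : d ∣ toℕ g → g ∈ Multiples d
    ∈-Multiples⁺ = ∈-tabulate⁺ (λ h → d ∣? toℕ h)

    ∈-Multiples⁻ : g ∈ Multiples d → d ∣ toℕ g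
    ∈-Multiples⁻ = ∈-tabulate⁻ (λ h → d ∣? toℕ h)

  multiples-isSubgroup : ∀ {d} → d ∣ n → IsSubgroup n (Multiples d)
  multiples-isSubgroup {d} d∣n =
      ∈-Multiples⁺ (subst (d ∣_) (sym toℕ-0ₙ) (d ∣0))
    , (λ g∈ h∈ → ∈-Multiples⁺ (∣mod (∣m∣n⇒∣m+n (∈-Multiples⁻ g∈) (∈-Multiples⁻ h∈))))
    , (λ g∈ → ∈-Multiples⁺ (∣mod (∣n∸ (∈-Multiples⁻ g∈))))
    where
    ∣mod : ∀ {a} → d ∣ a → d ∣ toℕ (a mod n)
    ∣mod d∣a = subst (d ∣_) (sym (toℕ-mod _)) (%-presˡ-∣ d∣a d∣n)
    ∣n∸ : ∀ {g : Fin n} → d ∣ toℕ g → d ∣ n ∸ toℕ g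
    ∣n∸ {g} = ∣m+n∣m⇒∣n (subst (d ∣_) (sym (m+[n∸m]≡n (<⇒≤ (toℕ<n g)))) d∣n)

  subgroup⇒≡Multiples : ∀ {C} → IsSubgroup n C → ∃[ d ] d ∣ n × C ≡ Multiples d
  subgroup⇒≡Multiples {C} (0∈C , +-closed , ⊖-closed) = d , to P⇔d∣ n∈C , ⊆-antisym C⊆M M⊆C
    where
    P : Pred ℕ _
    P a = a mod n ∈ C
    P-+ : ∀ {a b} → P a → P b → P (a + b)
    P-+ {a} {b} a∈C b∈C = subst (_∈ C) (sym (mod-+ a b)) (+-closed a∈C b∈C)
    P-cancel : ∀ {a b} → P (a + b) → P b → P a
    P-cancel {a} {b} a+b∈C b∈C =
      subst (_∈ C) ([x+ₙy]-ₙy≡x _ _) (+-closed (subst (_∈ C) (mod-+ a b) a+b∈C) (⊖-closed b∈C))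
    n∈C : P n
    n∈C = subst (_∈ C) (sym n-mod-n) 0∈C
    generator : ∃[ d ] (∀ {a} → P a ⇔ d ∣ a)
    generator = cancellative-submonoid⇒multiples (λ a → a mod n ∈? C) 0∈C P-+ P-cancel
                  (>-nonZero⁻¹ n) n∈C
    d : ℕ
    d = proj₁ generator
    P⇔d∣ : ∀ {a} → P a ⇔ d ∣ a
    P⇔d∣ = proj₂ generator
    C⊆M : ∀ {g} → g ∈ C → g ∈ Multiples d
    C⊆M {g} g∈C = ∈-Multiples⁺ (to P⇔d∣ (subst (_∈ C) (sym (mod-toℕ g)) g∈C))
    M⊆C : ∀ {g} → g ∈ Multiples d → g ∈ C
    M⊆C {g} g∈M = subst (_∈ C) (mod-toℕ g) (from P⇔d∣ (∈-Multiples⁻ g∈M))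

module _ {n : ℕ} .{{_ : NonZero n}} (S : Subset n) where

  ResiduesDistinct : (d : ℕ) .{{_ : NonZero d}} → Set
  ResiduesDistinct d = ∀ {s s′} → s ∈ S → s′ ∈ S → toℕ s % d ≡ toℕ s′ % d → s ≡ s′

  residuesDistinct⇔incongruent : ∀ {d} .{{_ : NonZero d}} → ResiduesDistinct d ⇔
    (∀ {s s′ : Fin n} → s ∈ S → s′ ∈ S → ¬ (s ≡ s′) → ¬ (toℕ s ≡ toℕ s′ [mod d ]))
  residuesDistinct⇔incongruent = mk⇔
    (λ distinct {s} {s′} s∈S s′∈S s≢s′ →
       s≢s′ ∘ distinct s∈S s′∈S ∘ from (%≡%⇔≡[mod] (toℕ s) (toℕ s′)))
    (λ incongruent {s} {s′} s∈S s′∈S eq → decidable-stable (s ≟ s′)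
       (λ s≢s′ → incongruent s∈S s′∈S s≢s′ (to (%≡%⇔≡[mod] (toℕ s) (toℕ s′)) eq)))

  module _ {d : ℕ} .{{_ : NonZero d}} (distinct : ResiduesDistinct d) where

    private
      residue : Fin n → Fin d
      residue s = toℕ s mod d

      residue-injectiveOn : InjectiveOn residue S
      residue-injectiveOn s∈S s′∈S = distinct s∈S s′∈S ∘ mod≡mod⇒%≡%

    residuesDistinct⇒∣S∣≤d : ∣ S ∣ ≤ d
    residuesDistinct⇒∣S∣≤d =
      subst (∣ S ∣ ≤_) (∣⊤∣≡n d) (injectiveOn⇒∣p∣≤∣q∣ residue (λ _ → ∈⊤) residue-injectiveOn)

    residuesDistinct⇒onto : ∣ S ∣ ≡ d → ∀ a → ∃[ s ] s ∈ S × toℕ s % d ≡ a % d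
    residuesDistinct⇒onto ∣S∣≡d a
      with (s , s∈S , s≡a) ← injectiveOn⇒onto residue (λ _ → ∈⊤) residue-injectiveOn
                               (≤-reflexive (trans (∣⊤∣≡n d) (sym ∣S∣≡d))) (∈⊤ {x = a mod d})
      = s , s∈S , mod≡mod⇒%≡% s≡a

module _ {n : ℕ} .{{_ : NonZero n}} (S : Subset n) (regular : Regular n S ∣ S ∣) where

  double∉S : ∀ g → g +ₙ g ∉ S
  double∉S g g+g∈S = <-irrefl (regular g)
    (injectiveOn-missing⇒∣p∣<∣q∣ (g +ₙ_) (proj₁ ∘ adjacent) (λ _ _ → +ₙ-cancelˡ g) g+g∈S
       (λ h∈N g+h≡g+g → proj₂ (adjacent h∈N) (sym (+ₙ-cancelˡ g g+h≡g+g))))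
    where
    adjacent : ∀ {h} → h ∈ nbhd n S g → Adj n S g h
    adjacent = ∈-tabulate⁻ (adj? n S g)

  sum∈S⇒Adj : ∀ {g h} → g +ₙ h ∈ S → Adj n S g h
  sum∈S⇒Adj {g} g+h∈S = g+h∈S , λ { refl → double∉S g g+h∈S }

  totalPerfectCode-unique : ∀ {C g h h′} → TotalPerfectCode n S C → h ∈ C → h′ ∈ C →
                            g +ₙ h ∈ S → g +ₙ h′ ∈ S → h ≡ h′
  totalPerfectCode-unique {g = g} tpc h∈C h′∈C g+h∈S g+h′∈S =
    let (_ , _ , unique) = tpc g
    in trans (sym (unique (h∈C , sum∈S⇒Adj g+h∈S))) (unique (h′∈C , sum∈S⇒Adj g+h′∈S))

  module _ {d : ℕ} .{{_ : NonZero d}} (d∣n : d ∣ n) where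

    multiplesTPC⇒residuesDistinct : TotalPerfectCode n S (Multiples d) → ResiduesDistinct S d
    multiplesTPC⇒residuesDistinct tpc {s} {s′} s∈S s′∈S eq = begin
      s                ≡⟨ x+ₙ[y-ₙx]≡y s′ s ⟨
      s′ +ₙ (s -ₙ s′)  ≡⟨ cong (s′ +ₙ_) 0≡s-s′ ⟨
      s′ +ₙ 0ₙ n       ≡⟨ +ₙ-identityʳ s′ ⟩
      s′               ∎
      where
      open ≡-Reasoning
      0≡s-s′ : 0ₙ n ≡ s -ₙ s′
      0≡s-s′ = totalPerfectCode-unique tpc (proj₁ (multiples-isSubgroup d∣n))
                 (∈-Multiples⁺ (%≡%⇒∣toℕ[x-ₙy] d∣n s s′ eq))
                 (subst (_∈ S) (sym (+ₙ-identityʳ s′)) s′∈S)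
                 (subst (_∈ S) (sym (x+ₙ[y-ₙx]≡y s′ s)) s∈S)

    multiplesTPC⇒d≤∣S∣ : TotalPerfectCode n S (Multiples d) → d ≤ ∣ S ∣
    multiplesTPC⇒d≤∣S∣ tpc =
      subst (_≤ ∣ S ∣) (∣⊤∣≡n d) (injectiveOn⇒∣p∣≤∣q∣ {p = ⊤} φ (λ {r} _ → φ∈S r) φ-injective)
      where
      ι : Fin d → Fin n
      ι r = toℕ r mod n
      code : Fin d → Fin n
      code r = proj₁ (tpc (ι r))
      code∈M : ∀ r → code r ∈ Multiples d
      code∈M r = proj₁ (proj₁ (proj₂ (tpc (ι r))))
      φ : Fin d → Fin n
      φ r = ι r +ₙ code r
      φ∈S : ∀ r → φ r ∈ S
      φ∈S r = proj₁ (proj₂ (proj₁ (proj₂ (tpc (ι r)))))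
      residue-φ : ∀ r → toℕ (φ r) % d ≡ toℕ r
      residue-φ r = begin
        toℕ (φ r) % d   ≡⟨ %-remove-+ₙʳ d∣n (ι r) (∈-Multiples⁻ (code∈M r)) ⟩
        toℕ (ι r) % d   ≡⟨ cong (_% d) (toℕ-mod (toℕ r)) ⟩
        toℕ r % n % d   ≡⟨ m∣n⇒o%n%m≡o%m d n (toℕ r) d∣n ⟩
        toℕ r % d       ≡⟨ m<n⇒m%n≡m (toℕ<n r) ⟩
        toℕ r           ∎
        where open ≡-Reasoning
      φ-injective : InjectiveOn φ ⊤
      φ-injective {r} {r′} _ _ φr≡φr′ = toℕ-injective
        (trans (sym (residue-φ r)) (trans (cong (λ x → toℕ x % d) φr≡φr′) (residue-φ r′)))

    multiplesTPC⇒∣S∣≡d : TotalPerfectCode n S (Multiples d) → ∣ S ∣ ≡ d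
    multiplesTPC⇒∣S∣≡d tpc = ≤-antisym
      (residuesDistinct⇒∣S∣≤d S (multiplesTPC⇒residuesDistinct tpc)) (multiplesTPC⇒d≤∣S∣ tpc)

    residuesDistinct⇒multiplesTPC : ∣ S ∣ ≡ d → ResiduesDistinct S d →
                                    TotalPerfectCode n S (Multiples d)
    residuesDistinct⇒multiplesTPC ∣S∣≡d distinct g
      with (s , s∈S , s≡g) ← residuesDistinct⇒onto S distinct ∣S∣≡d (toℕ g)
      = s -ₙ g , (∈-Multiples⁺ (%≡%⇒∣toℕ[x-ₙy] d∣n s g s≡g) , sum∈S⇒Adj g+[s-g]∈S) , unique
      where
      g+[s-g]∈S : g +ₙ (s -ₙ g) ∈ S
      g+[s-g]∈S = subst (_∈ S) (sym (x+ₙ[y-ₙx]≡y g s)) s∈S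
      unique : ∀ {h} → h ∈ Multiples d × Adj n S g h → s -ₙ g ≡ h
      unique (h∈M , g+h∈S , _) = +ₙ-cancelˡ g (trans (x+ₙ[y-ₙx]≡y g s)
        (distinct s∈S g+h∈S (trans s≡g (sym (%-remove-+ₙʳ d∣n g (∈-Multiples⁻ h∈M))))))

  hasSubgroupTPC⇒residuesDistinct : .{{_ : NonZero ∣ S ∣}} → ∣ S ∣ ∣ n →
                                    HasSubgroupTPC n S → ResiduesDistinct S ∣ S ∣
  hasSubgroupTPC⇒residuesDistinct ∣S∣∣n (C , subgroup , tpc) = multiplesTPC⇒residuesDistinct ∣S∣∣n
    (subst (TotalPerfectCode n S ∘ Multiples) (sym (multiplesTPC⇒∣S∣≡d d∣n multiplesTPC))
           multiplesTPC)
    where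
    d : ℕ
    d = proj₁ (subgroup⇒≡Multiples subgroup)
    d∣n : d ∣ n
    d∣n = proj₁ (proj₂ (subgroup⇒≡Multiples subgroup))
    multiplesTPC : TotalPerfectCode n S (Multiples d)
    multiplesTPC = subst (TotalPerfectCode n S) (proj₂ (proj₂ (subgroup⇒≡Multiples subgroup))) tpc
    instance
      _ : NonZero d
      _ = ∣-nonZero d∣n

  hasSubgroupTPC⇔residuesDistinct : .{{_ : NonZero ∣ S ∣}} → ∣ S ∣ ∣ n →
                                    HasSubgroupTPC n S ⇔ ResiduesDistinct S ∣ S ∣
  hasSubgroupTPC⇔residuesDistinct ∣S∣∣n = mk⇔ (hasSubgroupTPC⇒residuesDistinct ∣S∣∣n)
    (λ distinct → Multiples ∣ S ∣ , multiples-isSubgroup ∣S∣∣n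
                , residuesDistinct⇒multiplesTPC ∣S∣∣n refl distinct)

theorem3p2 : (n : ℕ) .{{_ : NonZero n}} → 4 ≤ n → (S : Subset n)
    → Connected n S → Regular n S ∣ S ∣ → (∣ S ∣) ∣ n
    → HasSubgroupTPC n S
      ⇔ (∀ {s s′ : Fin n} → s ∈ S → s′ ∈ S → ¬ (s ≡ s′)
           → ¬ (toℕ s ≡ toℕ s′ [mod ∣ S ∣ ]))
theorem3p2 n _ S _ regular ∣S∣∣n =
  residuesDistinct⇔incongruent S ⇔-∘ hasSubgroupTPC⇔residuesDistinct S regular ∣S∣∣n
  where
  instance
    _ : NonZero ∣ S ∣
    _ = ∣-nonZero ∣S∣∣n
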